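{- Let $\mathcal{I}$ be the Grassmann necklace with decorated permutation $\pi$ and $\mathcal{J}$ be the Grassmann necklace with decorated permutation $\pi^{ -1}.$ Then the following is true: \[\mathcal{G}^{\mathcal{I}} \cong \mathcal{G}^{\mathcal{J}}. \]
   Context: Connected Grassmann necklaces $\mathcal{I}=(I_1,\ldots,I_n)$ of $k$-subsets of $[n]$ are in bijection with connected decorated permutations via $\pi(i)=j$ when $I_{i+1}=(I_i\setminus\{i\})\cup\{j\}$. The exchange graph $\mathcal{G}^{\mathcal{I}}$ has as vertices the maximal weakly separated collections over $\mathcal{I}$ (inside the positroid $\mathcal{M}_{\mathcal{I}}$), with an edge between two collections related by a single mutation. -}

module Defs where

open import Data.Nat using (ℕ; zero; suc; _+_; _∸_; _<_; _≤_; _≤ᵇ_)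
open import Data.Nat.DivMod using (_%_; m%n<n)
open import Data.Bool using (Bool; true; false; if_then_else_; _≟_)
open import Data.Fin using (Fin; toℕ; fromℕ<)
open import Data.Fin.Subset using (Subset; _∈_; _∉_; _-_; _∪_; _∩_; ∁; ⁅_⁆; ∣_∣; Nonempty)
open import Data.Fin.Permutation using (Permutation′; _⟨$⟩ʳ_)
open import Data.List using (List; []; _∷_; filter)
open import Data.List.Relation.Binary.Pointwise using (Pointwise)
open import Data.Vec using (lookup)
open import Data.Product using (Σ; _×_; ∃; ∃-syntax)
open import Relation.Nullary using (¬_)
open import Relation.Binary.PropositionalEquality using (_≡_; _≢_)

next : ∀ {n} → Fin n → Fin n
next {suc m} i = fromℕ< (m%n<n (suc (toℕ i)) (suc m))

-- position of a in the cyclic order  i <_i i+1 <_i ... <_i i-1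
-- (i.e. (a - i) mod n)
shift : ∀ {n} → Fin n → Fin n → ℕ
shift {n} i a = if toℕ i ≤ᵇ toℕ a then toℕ a ∸ toℕ i else (toℕ a + n) ∸ toℕ i

cyc : ∀ {n} → ℕ → Fin n → List (Fin n)
cyc zero    i = []
cyc (suc t) i = i ∷ cyc t (next i)

elemsFrom : ∀ {n} → Fin n → Subset n → List (Fin n)
elemsFrom {n} i S = filter (λ a → lookup S a ≟ true) (cyc n i)

-- Gale order ≤_i : A = {a₁ <_i ... <_i a_r}, B = {b₁ <_i ... <_i b_r},
-- A ≤_i B iff a_s ≤_i b_s for all s (and |A| = |B|)
GaleLeq : ∀ {n} → Fin n → Subset n → Subset n → Set
GaleLeq i A B = Pointwise (λ a b → shift i a ≤ shift i b) (elemsFrom i A) (elemsFrom i B)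

record GrassmannNecklace (n k : ℕ) : Set where
  field
    set      : Fin n → Subset n
    size     : ∀ i → ∣ set i ∣ ≡ k
    step-in  : ∀ i → i ∈ set i → ∃[ j ] (set (next i) ≡ (set i - i) ∪ ⁅ j ⁆)
    step-out : ∀ i → i ∉ set i → set (next i) ≡ set i

open GrassmannNecklace public

-- A decorated permutation: a permutation π of [n] together with a colouring
-- of [n] (only relevant at fixed points: true = coloop, i.e. i ∈ I_i;
-- false = loop, i.e. i ∉ I_i).
record IsNecklaceOf {n k : ℕ} (I : GrassmannNecklace n k)
                    (π : Permutation′ n) (col : Fin n → Bool) : Set where
  field
    moved  : ∀ i → i ∈ set I i → set I (next i) ≡ (set I i - i) ∪ ⁅ π ⟨$⟩ʳ i ⁆
    fixed  : ∀ i → i ∉ set I i → π ⟨$⟩ʳ i ≡ i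
    colour : ∀ i → π ⟨$⟩ʳ i ≡ i → (i ∈ set I i → col i ≡ true) × (col i ≡ true → i ∈ set I i)

InPositroid : ∀ {n k} → GrassmannNecklace n k → Subset n → Set
InPositroid {k = k} I S = (∣ S ∣ ≡ k) × (∀ i → GaleLeq i (set I i) S)

-- the matroid M_I is connected: there is no proper nonempty separator A,
-- i.e. no proper nonempty A ⊂ [n] that all bases meet in the same number
-- of elements (equivalently r(A) + r([n]∖A) = rk M).
Connected : ∀ {n k} → GrassmannNecklace n k → Set
Connected {n} I = ∀ (A : Subset n) → Nonempty A → Nonempty (∁ A) →
  ¬ (∀ B C → InPositroid I B → InPositroid I C → ∣ B ∩ A ∣ ≡ ∣ C ∩ A ∣)

CyclicallyOrdered : ∀ {n} → Fin n → Fin n → Fin n → Fin n → Set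
CyclicallyOrdered a b c d = (0 < shift a b) × (shift a b < shift a c) × (shift a c < shift a d)

WeaklySeparated : ∀ {n} → Subset n → Subset n → Set
WeaklySeparated S T = ∀ a b c d → CyclicallyOrdered a b c d →
  ¬ ((a ∈ S) × (a ∉ T) × (c ∈ S) × (c ∉ T) × (b ∈ T) × (b ∉ S) × (d ∈ T) × (d ∉ S))

Collection : ℕ → Set
Collection n = Subset n → Bool

_∈C_ : ∀ {n} → Subset n → Collection n → Set
S ∈C C = C S ≡ true

_≐_ : ∀ {n} → Collection n → Collection n → Set
C ≐ D = ∀ S → C S ≡ D S

WSCollection : ∀ {n k} → GrassmannNecklace n k → Collection n → Set
WSCollection I C = (∀ S → S ∈C C → InPositroid I S)
                 × (∀ S T → S ∈C C → T ∈C C → WeaklySeparated S T)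

-- maximal (by inclusion) weakly separated collection inside M_I:
-- the vertices of the exchange graph G^I
MaxWSC : ∀ {n k} → GrassmannNecklace n k → Collection n → Set
MaxWSC I C = WSCollection I C
  × (∀ D → WSCollection I D → (∀ S → S ∈C C → S ∈C D) → ∀ S → S ∈C D → S ∈C C)

Mutation : ∀ {n} → Collection n → Collection n → Set
Mutation {n} C D = Σ (Subset n) λ S → Σ (Subset n) λ T →
  (S ≢ T) × (S ∈C C) × (D S ≡ false) × (T ∈C D) × (C T ≡ false)
  × (∀ U → U ≢ S → U ≢ T → C U ≡ D U)

-- an isomorphism of exchange graphs G^I ≅ G^J: a bijection between the
-- vertex sets (collections taken up to extensional equality) which
-- preserves and reflects adjacency (= being related by one mutation).
record ExchangeGraphIso {n k l : ℕ} (I : GrassmannNecklace n k)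
                        (J : GrassmannNecklace n l) : Set where
  field
    to       : Collection n → Collection n
    from     : Collection n → Collection n
    to-cong   : ∀ C C′ → C ≐ C′ → to C ≐ to C′
    from-cong : ∀ D D′ → D ≐ D′ → from D ≐ from D′
    to-vertex   : ∀ C → MaxWSC I C → MaxWSC J (to C)
    from-vertex : ∀ D → MaxWSC J D → MaxWSC I (from D)
    from-to  : ∀ C → MaxWSC I C → from (to C) ≐ C
    to-from  : ∀ D → MaxWSC J D → to (from D) ≐ D
    edge-to   : ∀ C C′ → MaxWSC I C → MaxWSC I C′ → Mutation C C′ → Mutation (to C) (to C′)
    edge-from : ∀ D D′ → MaxWSC J D → MaxWSC J D′ → Mutation D D′ → Mutation (from D) (from D′)

{-# OPTIONS --safe #-}
module Submission where

-- If π has no fixed points, the necklace J of π⁻¹ is dual to the necklace I of π: for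
-- every i and t ≤ n, the first t elements i, i+1, …, i+t-1 of the cyclic order contain
-- exactly t elements of J_i and I_{i+t} together. Read the Gale order A ≤_i B as
-- "every initial segment of the i-order holds at least as many elements of A as of B".
-- Then the identity turns the Gale conditions defining M_J into those defining
-- M_I for complements, so M_J = {[n] ∖ S : S ∈ M_I}. Complementation preserves weak
-- separation and mutations, so pulling collections back along it is the isomorphism.
-- Connectedness rules out fixed points once n ≥ 2, since a loop or coloop x makes {x}
-- a separator. For n ≤ 1 both exchange graphs are trivial.

open import Defs
open import Data.Bool using (Bool; true; false; not; _∨_; T; if_then_else_)
open import Data.Bool.Properties using (not-involutive; ∨-zeroʳ; ∨-identityʳ) renaming (_≟_ to _≟ᵇ_)
open import Data.Empty using (⊥-elim)
open import Data.Fin using (Fin; zero; suc; toℕ)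
open import Data.Fin.Properties using (toℕ-fromℕ<; toℕ-injective; toℕ<n)
open import Data.Fin.Permutation using (Permutation′; _⟨$⟩ʳ_; _⟨$⟩ˡ_; inverseˡ; inverseʳ; flip)
open import Data.Fin.Subset using (Subset; ∁; ∣_∣; _∉_; _∪_; _∩_; _─_; _-_; ⁅_⁆)
import Data.Fin.Subset as Subset
open import Data.Fin.Subset.Properties using (x∈⁅x⁆; x∈⁅y⁆⇒x≡y; x≢y⇒x∉⁅y⁆; x∉p⇒x∈∁p; x∈p⇒x∉∁p)
open import Data.List using (List; []; _∷_; _++_; _∷ʳ_; length; map; filter)
open import Data.List.Properties using (∷ʳ-++; length-++)
open import Data.List.Relation.Binary.Pointwise using (Pointwise; []; _∷_; map⁺; map⁻)
open import Data.List.Relation.Unary.All as All using (All; []; _∷_)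
open import Data.List.Relation.Unary.All.Properties using (∷ʳ⁺)
open import Data.Nat
open import Data.Nat.DivMod
open import Data.Nat.Properties
open import Data.Nat.Solver using (module +-*-Solver)
open import Data.Product using (_×_; _,_; proj₁; proj₂)
open import Data.Vec using (Vec; []; _∷_; lookup)
open import Data.Vec.Properties using (lookup-map; lookup-zipWith; []=⇒lookup; lookup⇒[]=)
open import Function using (case_of_; id)
open import Function.Bundles using (_⇔_; mk⇔; Equivalence)
open import Relation.Binary.Definitions using (tri<; tri≈; tri>)
open import Relation.Binary.PropositionalEquality
open import Relation.Nullary using (¬_; yes; no)

open +-*-Solver using (solve; _:+_; _:=_)

advance : ∀ {n} → ℕ → Fin n → Fin n
advance zero    i = i
advance (suc p) i = advance p (next i)

advance-suc : ∀ {n} p (i : Fin n) → advance (suc p) i ≡ next (advance p i)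
advance-suc zero    i = refl
advance-suc (suc p) i = advance-suc p (next i)

advance-+ : ∀ {n} p q (i : Fin n) → advance (p + q) i ≡ advance q (advance p i)
advance-+ zero    q i = refl
advance-+ (suc p) q i = advance-+ p q (next i)

module _ {m : ℕ} where
  private
    n = suc m

  [m%n+p]%n≡[m+p]%n : ∀ a p → ((a % n) + p) % n ≡ (a + p) % n
  [m%n+p]%n≡[m+p]%n a p = begin
    ((a % n) + p) % n            ≡⟨ %-distribˡ-+ (a % n) p n ⟩
    ((a % n % n) + (p % n)) % n  ≡⟨ cong (λ z → (z + p % n) % n) (m%n%n≡m%n a n) ⟩
    ((a % n) + (p % n)) % n      ≡⟨ %-distribˡ-+ a p n ⟨
    (a + p) % n                  ∎
    where open ≡-Reasoning

  toℕ-next : (i : Fin n) → toℕ (next i) ≡ suc (toℕ i) % n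
  toℕ-next i = toℕ-fromℕ< _

  toℕ-advance : ∀ p (i : Fin n) → toℕ (advance p i) ≡ (toℕ i + p) % n
  toℕ-advance zero    i = sym (trans (cong (_% n) (+-identityʳ (toℕ i))) (m<n⇒m%n≡m (toℕ<n i)))
  toℕ-advance (suc p) i = begin
    toℕ (advance p (next i))     ≡⟨ toℕ-advance p (next i) ⟩
    (toℕ (next i) + p) % n       ≡⟨ cong (λ z → (z + p) % n) (toℕ-next i) ⟩
    ((suc (toℕ i) % n) + p) % n  ≡⟨ [m%n+p]%n≡[m+p]%n (suc (toℕ i)) p ⟩
    (suc (toℕ i) + p) % n        ≡⟨ cong (_% n) (+-suc (toℕ i) p) ⟨
    (toℕ i + suc p) % n          ∎
    where open ≡-Reasoning

  advance-n : (i : Fin n) → advance n i ≡ i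
  advance-n i = toℕ-injective (begin
    toℕ (advance n i)  ≡⟨ toℕ-advance n i ⟩
    (toℕ i + n) % n    ≡⟨ [m+n]%n≡m%n (toℕ i) n ⟩
    toℕ i % n          ≡⟨ m<n⇒m%n≡m (toℕ<n i) ⟩
    toℕ i              ∎)
    where open ≡-Reasoning

  advance-around : (i : Fin n) (s t : ℕ) → s + t ≡ n → advance t (advance s i) ≡ i
  advance-around i s t s+t≡n =
    trans (sym (advance-+ s t i)) (trans (cong (λ z → advance z i) s+t≡n) (advance-n i))

  shift-≤ : (i x : Fin n) → toℕ i ≤ toℕ x → shift i x ≡ toℕ x ∸ toℕ i
  shift-≤ i x i≤x with toℕ i ≤ᵇ toℕ x in eq
  ... | true  = refl
  ... | false = ⊥-elim (subst T eq (≤⇒≤ᵇ i≤x))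

  shift-> : (i x : Fin n) → toℕ x < toℕ i → shift i x ≡ toℕ x + n ∸ toℕ i
  shift-> i x x<i with toℕ i ≤ᵇ toℕ x in eq
  ... | true  = ⊥-elim (<⇒≱ x<i (≤ᵇ⇒≤ (toℕ i) (toℕ x) (subst T (sym eq) _)))
  ... | false = refl

  i≤x+n : (i x : Fin n) → toℕ i ≤ toℕ x + n
  i≤x+n i x = ≤-trans (<⇒≤ (toℕ<n i)) (m≤n+m n (toℕ x))

  shift<n : (i x : Fin n) → shift i x < n
  shift<n i x with toℕ i ≤? toℕ x
  ... | yes i≤x = subst (_< n) (sym (shift-≤ i x i≤x)) (≤-<-trans (m∸n≤m (toℕ x) (toℕ i)) (toℕ<n x))
  ... | no  i≰x = subst (_< n) (sym (shift-> i x (≰⇒> i≰x))) (+-cancelʳ-< (toℕ i) _ n (begin-strict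
    toℕ x + n ∸ toℕ i + toℕ i  ≡⟨ m∸n+n≡m (i≤x+n i x) ⟩
    toℕ x + n                  <⟨ +-monoˡ-< n (≰⇒> i≰x) ⟩
    toℕ i + n                  ≡⟨ +-comm (toℕ i) n ⟩
    n + toℕ i                  ∎))
    where open ≤-Reasoning

  advance-shift : (i x : Fin n) → advance (shift i x) i ≡ x
  advance-shift i x = toℕ-injective (trans (toℕ-advance (shift i x) i) i+shift)
    where
    open ≡-Reasoning
    i+shift : (toℕ i + shift i x) % n ≡ toℕ x
    i+shift with toℕ i ≤? toℕ x
    ... | yes i≤x = begin
      (toℕ i + shift i x) % n            ≡⟨ cong (λ z → (toℕ i + z) % n) (shift-≤ i x i≤x) ⟩
      (toℕ i + (toℕ x ∸ toℕ i)) % n      ≡⟨ cong (_% n) (m+[n∸m]≡n i≤x) ⟩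
      toℕ x % n                          ≡⟨ m<n⇒m%n≡m (toℕ<n x) ⟩
      toℕ x                              ∎
    ... | no i≰x = begin
      (toℕ i + shift i x) % n            ≡⟨ cong (λ z → (toℕ i + z) % n) (shift-> i x (≰⇒> i≰x)) ⟩
      (toℕ i + (toℕ x + n ∸ toℕ i)) % n  ≡⟨ cong (_% n) (m+[n∸m]≡n (i≤x+n i x)) ⟩
      (toℕ x + n) % n                    ≡⟨ [m+n]%n≡m%n (toℕ x) n ⟩
      toℕ x % n                          ≡⟨ m<n⇒m%n≡m (toℕ<n x) ⟩
      toℕ x                              ∎

  shift-advance : (i : Fin n) {p : ℕ} → p < n → shift i (advance p i) ≡ p
  shift-advance i {p} p<n with toℕ i + p <? n
  ... | yes i+p<n = begin
    shift i (advance p i)      ≡⟨ shift-≤ i (advance p i) (subst (toℕ i ≤_) (sym pos) (m≤m+n (toℕ i) p)) ⟩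
    toℕ (advance p i) ∸ toℕ i  ≡⟨ cong (_∸ toℕ i) pos ⟩
    toℕ i + p ∸ toℕ i          ≡⟨ m+n∸m≡n (toℕ i) p ⟩
    p                          ∎
    where
    open ≡-Reasoning
    pos : toℕ (advance p i) ≡ toℕ i + p
    pos = trans (toℕ-advance p i) (m<n⇒m%n≡m i+p<n)
  ... | no i+p≮n = begin
    shift i (advance p i)          ≡⟨ shift-> i (advance p i) (subst (_< toℕ i) (sym pos) wrapped<i) ⟩
    toℕ (advance p i) + n ∸ toℕ i  ≡⟨ cong (λ z → z + n ∸ toℕ i) pos ⟩
    toℕ i + p ∸ n + n ∸ toℕ i      ≡⟨ cong (_∸ toℕ i) (m∸n+n≡m n≤i+p) ⟩
    toℕ i + p ∸ toℕ i              ≡⟨ m+n∸m≡n (toℕ i) p ⟩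
    p                              ∎
    where
    open ≡-Reasoning
    n≤i+p : n ≤ toℕ i + p
    n≤i+p = ≮⇒≥ i+p≮n
    wrapped<i : toℕ i + p ∸ n < toℕ i
    wrapped<i = +-cancelʳ-< n _ (toℕ i)
      (subst (_< toℕ i + n) (sym (m∸n+n≡m n≤i+p)) (+-monoʳ-< (toℕ i) p<n))
    pos : toℕ (advance p i) ≡ toℕ i + p ∸ n
    pos = trans (toℕ-advance p i)
      (trans (sym (m≤n⇒[n∸m]%m≡n%m n≤i+p)) (m<n⇒m%n≡m (<-trans wrapped<i (toℕ<n i))))

  shift-self : (i : Fin n) → shift i i ≡ 0
  shift-self i = trans (shift-≤ i i ≤-refl) (n∸n≡0 (toℕ i))

  advance-injective : (i : Fin n) {p q : ℕ} → p < n → q < n → advance p i ≡ advance q i → p ≡ q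
  advance-injective i p<n q<n eq =
    trans (sym (shift-advance i p<n)) (trans (cong (shift i) eq) (shift-advance i q<n))

bit : Bool → ℕ
bit true  = 1
bit false = 0

count : (ℕ → Bool) → ℕ → ℕ → ℕ
count f o zero    = 0
count f o (suc t) = bit (f o) + count f (suc o) t

count-cong : ∀ f g o t → (∀ p → o ≤ p → p < o + t → f p ≡ g p) → count f o t ≡ count g o t
count-cong f g o zero    f≗g = refl
count-cong f g o (suc t) f≗g = cong₂ _+_
  (cong bit (f≗g o ≤-refl (m<m+n o (s≤s z≤n))))
  (count-cong f g (suc o) t λ p o<p p<o+1+t →
    f≗g p (<⇒≤ o<p) (subst (p <_) (sym (+-suc o t)) p<o+1+t))

count-reindex : ∀ f g s o t → (∀ p → f (s + p) ≡ g p) → count f (s + o) t ≡ count g o t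
count-reindex f g s o zero    f≗g = refl
count-reindex f g s o (suc t) f≗g = cong₂ _+_ (cong bit (f≗g o))
  (trans (cong (λ z → count f z t) (sym (+-suc s o))) (count-reindex f g s (suc o) t f≗g))

count-split : ∀ f o s t → count f o (s + t) ≡ count f o s + count f (o + s) t
count-split f o zero    t = cong (λ z → count f z t) (sym (+-identityʳ o))
count-split f o (suc s) t = begin
  bit (f o) + count f (suc o) (s + t)
    ≡⟨ cong (bit (f o) +_) (count-split f (suc o) s t) ⟩
  bit (f o) + (count f (suc o) s + count f (suc o + s) t)
    ≡⟨ +-assoc (bit (f o)) _ _ ⟨
  bit (f o) + count f (suc o) s + count f (suc o + s) t
    ≡⟨ cong (λ z → bit (f o) + count f (suc o) s + count f z t) (sym (+-suc o s)) ⟩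
  bit (f o) + count f (suc o) s + count f (o + suc s) t
    ∎
  where open ≡-Reasoning

count-snoc : ∀ f o t → count f o (suc t) ≡ count f o t + bit (f (o + t))
count-snoc f o t = begin
  count f o (suc t)                    ≡⟨ cong (count f o) (+-comm 1 t) ⟩
  count f o (t + 1)                    ≡⟨ count-split f o t 1 ⟩
  count f o t + (bit (f (o + t)) + 0)  ≡⟨ cong (count f o t +_) (+-identityʳ _) ⟩
  count f o t + bit (f (o + t))        ∎
  where open ≡-Reasoning

count-not : ∀ f g o t → (∀ p → g p ≡ not (f p)) → count g o t + count f o t ≡ t
count-not f g o zero    g≗¬f = refl
count-not f g o (suc t) g≗¬f with f o | g o | g≗¬f o | count-not f g (suc o) t g≗¬f
... | true  | .false | refl | eq = trans (+-suc _ _) (cong suc eq)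
... | false | .true  | refl | eq = cong suc eq

count-single-difference : ∀ f g v o t → o ≤ v → v < o + t → f v ≡ true → g v ≡ false →
  (∀ p → o ≤ p → p < o + t → p ≢ v → f p ≡ g p) → count f o t ≡ suc (count g o t)
count-single-difference f g v o zero o≤v v<o _ _ _ =
  ⊥-elim (<⇒≱ v<o (subst (_≤ v) (sym (+-identityʳ o)) o≤v))
count-single-difference f g v o (suc t) o≤v v<o+1+t fv gv f≗g with o ≟ v
... | yes refl rewrite fv | gv = cong suc (count-cong f g (suc o) t λ p o<p p<o+1+t →
  f≗g p (<⇒≤ o<p) (subst (p <_) (sym (+-suc o t)) p<o+1+t) (>⇒≢ o<p))
... | no o≢v = trans
  (cong₂ _+_ (cong bit (f≗g o ≤-refl (m<m+n o (s≤s z≤n)) o≢v))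
    (count-single-difference f g v (suc o) t (≤∧≢⇒< o≤v o≢v) (subst (v <_) (+-suc o t) v<o+1+t) fv gv
      λ p o<p p<o+1+t → f≗g p (<⇒≤ o<p) (subst (p <_) (sym (+-suc o t)) p<o+1+t)))
  (+-suc (bit (g o)) _)

-- Gale order as domination of prefix counts

select : (ℕ → Bool) → ℕ → ℕ → List ℕ
select f o zero    = []
select f o (suc t) = if f o then o ∷ select f (suc o) t else select f (suc o) t

select-≥ : ∀ f o t → All (o ≤_) (select f o t)
select-≥ f o zero    = []
select-≥ f o (suc t) with f o
... | true  = ≤-refl ∷ All.map (≤-trans (n≤1+n o)) (select-≥ f (suc o) t)
... | false = All.map (≤-trans (n≤1+n o)) (select-≥ f (suc o) t)

record Dominance (a b : ℕ → Bool) (o t d : ℕ) : Set where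
  constructor dominance
  field
    prefix : ∀ s → s ≤ t → count b o s ≤ d + count a o s
    total  : d + count a o t ≡ count b o t

dominance-step : ∀ {a b o t d d′ x y} → a o ≡ x → b o ≡ y → bit y + d′ ≡ bit x + d →
                 Dominance a b (suc o) t d′ ⇔ Dominance a b o (suc t) d
dominance-step {a} {b} {o} {t} {d} {d′} {x} {y} refl refl balance = mk⇔
  (λ (dominance prefix total) → dominance
    (λ { zero    _         → z≤n
       ; (suc s) (s≤s s≤t) → ≤-trans (+-monoʳ-≤ (bit y) (prefix s s≤t)) (≤-reflexive (move _)) })
    (trans (sym (move _)) (cong (bit y +_) total)))
  (λ (dominance prefix total) → dominance
    (λ s s≤t → +-cancelˡ-≤ (bit y) _ _ (≤-trans (prefix (suc s) (s≤s s≤t)) (≤-reflexive (sym (move _)))))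
    (+-cancelˡ-≡ (bit y) _ _ (trans (move _) total)))
  where
  move : ∀ c → bit y + (d′ + c) ≡ d + (bit x + c)
  move c = begin
    bit y + (d′ + c)  ≡⟨ +-assoc (bit y) d′ c ⟨
    bit y + d′ + c    ≡⟨ cong (_+ c) balance ⟩
    bit x + d + c     ≡⟨ cong (_+ c) (+-comm (bit x) d) ⟩
    d + bit x + c     ≡⟨ +-assoc d (bit x) c ⟩
    d + (bit x + c)   ∎
    where open ≡-Reasoning

dominance-head : ∀ {a b o t d} → Dominance a b o (suc t) d → bit (b o) ≤ d + bit (a o)
dominance-head {d = d} (dominance prefix _) =
  subst₂ (λ u v → u ≤ d + v) (+-identityʳ _) (+-identityʳ _) (prefix 1 (s≤s z≤n))

length-∷ʳ : ∀ (qs : List ℕ) o → length (qs ∷ʳ o) ≡ suc (length qs)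
length-∷ʳ qs o = trans (length-++ qs) (+-comm (length qs) 1)

All<-suc : ∀ {o} {qs : List ℕ} → All (_< o) qs → All (_< suc o) qs
All<-suc = All.map m<n⇒m<1+n

All<-∷ʳ : ∀ {o} {qs : List ℕ} → All (_< o) qs → All (_< suc o) (qs ∷ʳ o)
All<-∷ʳ qs<o = ∷ʳ⁺ (All<-suc qs<o) ≤-refl

pointwise-∷ʳ⁺ : ∀ qs o {xs ys : List ℕ} → Pointwise _≤_ (qs ++ o ∷ xs) ys → Pointwise _≤_ (qs ∷ʳ o ++ xs) ys
pointwise-∷ʳ⁺ qs o = subst (λ zs → Pointwise _≤_ zs _) (sym (∷ʳ-++ qs o _))

pointwise-∷ʳ⁻ : ∀ qs o {xs ys : List ℕ} → Pointwise _≤_ (qs ∷ʳ o ++ xs) ys → Pointwise _≤_ (qs ++ o ∷ xs) ys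
pointwise-∷ʳ⁻ qs o = subst (λ zs → Pointwise _≤_ zs _) (∷ʳ-++ qs o _)

-- qs is the queue of positions of a, all before o, not yet matched with a position of b.
pointwise⇒dominance : ∀ a b o t (qs : List ℕ) → All (_< o) qs →
  Pointwise _≤_ (qs ++ select a o t) (select b o t) → Dominance a b o t (length qs)
pointwise⇒dominance a b o zero [] _ [] = dominance (λ { zero _ → z≤n }) refl
pointwise⇒dominance a b o (suc t) qs qs<o pw with a o in ao | b o in bo | qs | qs<o | pw
... | false | false | qs | qs<o | pw = Equivalence.to (dominance-step ao bo refl)
  (pointwise⇒dominance a b (suc o) t qs (All<-suc qs<o) pw)
... | true  | false | qs | qs<o | pw = Equivalence.to (dominance-step ao bo (length-∷ʳ qs o))
  (pointwise⇒dominance a b (suc o) t (qs ∷ʳ o) (All<-∷ʳ qs<o) (pointwise-∷ʳ⁺ qs o pw))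
... | false | true  | [] | [] | pw = ⊥-elim (unmatched (select-≥ a (suc o) t) pw)
  where
  unmatched : ∀ {xs ys} → All (suc o ≤_) xs → ¬ Pointwise _≤_ xs (o ∷ ys)
  unmatched (o<x ∷ _) (x≤o ∷ _) = <⇒≱ o<x x≤o
... | false | true  | q ∷ qs | _ ∷ qs<o | _ ∷ pw = Equivalence.to (dominance-step ao bo refl)
  (pointwise⇒dominance a b (suc o) t qs (All<-suc qs<o) pw)
... | true  | true  | [] | [] | _ ∷ pw = Equivalence.to (dominance-step ao bo refl)
  (pointwise⇒dominance a b (suc o) t [] [] pw)
... | true  | true  | q ∷ qs | _ ∷ qs<o | _ ∷ pw = Equivalence.to (dominance-step ao bo (cong suc (length-∷ʳ qs o)))
  (pointwise⇒dominance a b (suc o) t (qs ∷ʳ o) (All<-∷ʳ qs<o) (pointwise-∷ʳ⁺ qs o pw))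

dominance⇒pointwise : ∀ a b o t (qs : List ℕ) → All (_< o) qs →
  Dominance a b o t (length qs) → Pointwise _≤_ (qs ++ select a o t) (select b o t)
dominance⇒pointwise a b o zero [] _ _ = []
dominance⇒pointwise a b o (suc t) qs qs<o dom with a o in ao | b o in bo | qs | qs<o | dom
... | false | false | qs | qs<o | dom =
  dominance⇒pointwise a b (suc o) t qs (All<-suc qs<o) (Equivalence.from (dominance-step ao bo refl) dom)
... | true  | false | qs | qs<o | dom = pointwise-∷ʳ⁻ qs o
  (dominance⇒pointwise a b (suc o) t (qs ∷ʳ o) (All<-∷ʳ qs<o)
    (Equivalence.from (dominance-step ao bo (length-∷ʳ qs o)) dom))
... | false | true  | [] | [] | dom =
  ⊥-elim (1+n≰n (subst₂ (λ x y → bit y ≤ bit x) ao bo (dominance-head dom)))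
... | false | true  | q ∷ qs | q<o ∷ qs<o | dom = <⇒≤ q<o ∷
  dominance⇒pointwise a b (suc o) t qs (All<-suc qs<o) (Equivalence.from (dominance-step ao bo refl) dom)
... | true  | true  | [] | [] | dom = ≤-refl ∷
  dominance⇒pointwise a b (suc o) t [] [] (Equivalence.from (dominance-step ao bo refl) dom)
... | true  | true  | q ∷ qs | q<o ∷ qs<o | dom = <⇒≤ q<o ∷ pointwise-∷ʳ⁻ qs o
  (dominance⇒pointwise a b (suc o) t (qs ∷ʳ o) (All<-∷ʳ qs<o)
    (Equivalence.from (dominance-step ao bo (cong suc (length-∷ʳ qs o))) dom))

member : ∀ {n} → Subset n → Fin n → ℕ → Bool
member X i p = lookup X (advance p i)

module _ {m : ℕ} where
  private
    n = suc m

  shift-elemsFrom : (S : Subset n) (i : Fin n) (o t : ℕ) → o + t ≤ n →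
    map (shift i) (filter (λ a → lookup S a ≟ᵇ true) (cyc t (advance o i))) ≡ select (member S i) o t
  shift-elemsFrom S i o zero    _       = refl
  shift-elemsFrom S i o (suc t) o+1+t≤n rewrite sym (advance-suc o i) with lookup S (advance o i)
  ... | true  = cong₂ _∷_ (shift-advance i (<-≤-trans (m<m+n o (s≤s z≤n)) o+1+t≤n))
                          (shift-elemsFrom S i (suc o) t (subst (_≤ n) (+-suc o t) o+1+t≤n))
  ... | false = shift-elemsFrom S i (suc o) t (subst (_≤ n) (+-suc o t) o+1+t≤n)

  galeLeq⇔dominance : (i : Fin n) (A B : Subset n) →
                      GaleLeq i A B ⇔ Dominance (member A i) (member B i) 0 n 0
  galeLeq⇔dominance i A B = mk⇔
    (λ A≤B → pointwise⇒dominance (member A i) (member B i) 0 n [] []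
      (subst₂ (Pointwise _≤_) (elems A) (elems B) (map⁺ (shift i) (shift i) A≤B)))
    (λ dom → map⁻ (shift i) (shift i) (subst₂ (Pointwise _≤_) (sym (elems A)) (sym (elems B))
      (dominance⇒pointwise (member A i) (member B i) 0 n [] [] dom)))
    where
    elems : ∀ S → map (shift i) (elemsFrom i S) ≡ select (member S i) 0 n
    elems S = shift-elemsFrom S i 0 n ≤-refl

countFrom : ∀ {n} → Subset n → Fin n → ℕ → ℕ
countFrom X i t = count (member X i) 0 t

lookupℕ : ∀ {n} → Vec Bool n → ℕ → Bool
lookupℕ []      _       = false
lookupℕ (b ∷ v) zero    = b
lookupℕ (b ∷ v) (suc p) = lookupℕ v p

lookupℕ-toℕ : ∀ {n} (v : Vec Bool n) (x : Fin n) → lookupℕ v (toℕ x) ≡ lookup v x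
lookupℕ-toℕ (b ∷ v) zero    = refl
lookupℕ-toℕ (b ∷ v) (suc x) = lookupℕ-toℕ v x

∣v∣≡count-lookupℕ : ∀ {n} (v : Vec Bool n) → ∣ v ∣ ≡ count (lookupℕ v) 0 n
∣v∣≡count-lookupℕ []                  = refl
∣v∣≡count-lookupℕ {suc n} (true  ∷ v) =
  cong suc (trans (∣v∣≡count-lookupℕ v) (sym (count-reindex _ _ 1 0 n λ _ → refl)))
∣v∣≡count-lookupℕ {suc n} (false ∷ v) =
  trans (∣v∣≡count-lookupℕ v) (sym (count-reindex _ _ 1 0 n λ _ → refl))

module _ {m : ℕ} where
  private
    n = suc m

  count-member : (X : Subset n) (i : Fin n) (s t : ℕ) → count (member X i) s t ≡ countFrom X (advance s i) t
  count-member X i s t = trans (cong (λ z → count (member X i) z t) (sym (+-identityʳ s)))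
    (count-reindex _ _ s 0 t λ p → cong (lookup X) (advance-+ s p i))

  countFrom-split : (X : Subset n) (i : Fin n) (s t : ℕ) →
                    countFrom X i (s + t) ≡ countFrom X i s + countFrom X (advance s i) t
  countFrom-split X i s t =
    trans (count-split (member X i) 0 s t) (cong (countFrom X i s +_) (count-member X i s t))

  countFrom-snoc : (X : Subset n) (i : Fin n) (t : ℕ) →
                   countFrom X i (suc t) ≡ countFrom X i t + bit (lookup X (advance t i))
  countFrom-snoc X i t = count-snoc (member X i) 0 t

  countFrom-∁ : (X : Subset n) (i : Fin n) (t : ℕ) → countFrom (∁ X) i t + countFrom X i t ≡ t
  countFrom-∁ X i t = count-not (member X i) (member (∁ X) i) 0 t λ p → lookup-map (advance p i) not X

  countFrom-next-snoc : (X : Subset n) (i : Fin n) →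
                        countFrom X (next i) n ≡ countFrom X (next i) m + bit (lookup X i)
  countFrom-next-snoc X i = trans (countFrom-snoc X (next i) m)
    (cong (λ z → countFrom X (next i) m + bit (lookup X z)) (advance-n i))

  countFrom-next : (X : Subset n) (i : Fin n) → countFrom X (next i) n ≡ countFrom X i n
  countFrom-next X i = begin
    countFrom X (next i) n                     ≡⟨ countFrom-next-snoc X i ⟩
    countFrom X (next i) m + bit (lookup X i)  ≡⟨ +-comm _ (bit (lookup X i)) ⟩
    bit (lookup X i) + countFrom X (next i) m  ≡⟨ cong (bit (lookup X i) +_) (count-member X i 1 m) ⟨
    countFrom X i n                            ∎
    where open ≡-Reasoning

  countFrom-advance : (X : Subset n) (i : Fin n) (p : ℕ) → countFrom X (advance p i) n ≡ countFrom X i n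
  countFrom-advance X i zero    = refl
  countFrom-advance X i (suc p) = trans (countFrom-advance X (next i) p) (countFrom-next X i)

  countFrom-zero : (X : Subset n) → countFrom X zero n ≡ ∣ X ∣
  countFrom-zero X = sym (trans (∣v∣≡count-lookupℕ X) (count-cong _ _ 0 n λ p _ p<n → begin
    lookupℕ X p                       ≡⟨ cong (lookupℕ X) (trans (toℕ-advance p zero) (m<n⇒m%n≡m p<n)) ⟨
    lookupℕ X (toℕ (advance p zero))  ≡⟨ lookupℕ-toℕ X (advance p zero) ⟩
    member X zero p                   ∎))
    where open ≡-Reasoning

  countFrom-full : (X : Subset n) (i : Fin n) → countFrom X i n ≡ ∣ X ∣
  countFrom-full X i = begin
    countFrom X i n                              ≡⟨ cong (λ z → countFrom X z n) (advance-shift zero i) ⟨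
    countFrom X (advance (shift zero i) zero) n  ≡⟨ countFrom-advance X zero (shift zero i) ⟩
    countFrom X zero n                           ≡⟨ countFrom-zero X ⟩
    ∣ X ∣                                        ∎
    where open ≡-Reasoning

  countFrom-around : (X : Subset n) (i : Fin n) → countFrom X (next i) m + bit (lookup X i) ≡ ∣ X ∣
  countFrom-around X i = trans (sym (countFrom-next-snoc X i)) (countFrom-full X (next i))

  countFrom-arcs : (X : Subset n) (i : Fin n) (s t : ℕ) → s + t ≡ n →
                   countFrom X i s + countFrom X (advance s i) t ≡ ∣ X ∣
  countFrom-arcs X i s t s+t≡n =
    trans (sym (countFrom-split X i s t)) (trans (cong (countFrom X i) s+t≡n) (countFrom-full X i))

  ∣∁X∣+∣X∣≡n : (X : Subset n) → ∣ ∁ X ∣ + ∣ X ∣ ≡ n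
  ∣∁X∣+∣X∣≡n X =
    trans (sym (cong₂ _+_ (countFrom-full (∁ X) zero) (countFrom-full X zero))) (countFrom-∁ X zero n)

  galeLeq⇒prefix : (i : Fin n) (A B : Subset n) → GaleLeq i A B →
                   ∀ t → t ≤ n → countFrom B i t ≤ countFrom A i t
  galeLeq⇒prefix i A B A≤B = Dominance.prefix (Equivalence.to (galeLeq⇔dominance i A B) A≤B)

  prefix⇒galeLeq : (i : Fin n) (A B : Subset n) → ∣ A ∣ ≡ ∣ B ∣ →
                   (∀ t → t ≤ n → countFrom B i t ≤ countFrom A i t) → GaleLeq i A B
  prefix⇒galeLeq i A B ∣A∣≡∣B∣ prefix = Equivalence.from (galeLeq⇔dominance i A B)
    (dominance prefix (trans (countFrom-full A i) (trans ∣A∣≡∣B∣ (sym (countFrom-full B i)))))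

∉⇒lookup≡false : ∀ {n} {x : Fin n} {S : Subset n} → x ∉ S → lookup S x ≡ false
∉⇒lookup≡false {x = x} {S} x∉S with lookup S x in eq
... | true  = ⊥-elim (x∉S (lookup⇒[]= x S eq))
... | false = refl

lookup-⁅x⁆ : ∀ {n} (x : Fin n) → lookup ⁅ x ⁆ x ≡ true
lookup-⁅x⁆ x = []=⇒lookup (x∈⁅x⁆ x)

lookup-⁅y⁆ : ∀ {n} {x y : Fin n} → x ≢ y → lookup ⁅ y ⁆ x ≡ false
lookup-⁅y⁆ {y = y} x≢y = ∉⇒lookup≡false (λ x∈⁅y⁆ → x≢y (x∈⁅y⁆⇒x≡y y x∈⁅y⁆))

lookup-─-inside : ∀ {n} (S T : Subset n) y → lookup T y ≡ true → lookup (S ─ T) y ≡ false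
lookup-─-inside (_ ∷ S) (true ∷ T) zero    _  = refl
lookup-─-inside (_ ∷ S) (_ ∷ T)    (suc y) eq = lookup-─-inside S T y eq

lookup-─-outside : ∀ {n} (S T : Subset n) y → lookup T y ≡ false → lookup (S ─ T) y ≡ lookup S y
lookup-─-outside (_ ∷ S) (false ∷ T) zero    _  = refl
lookup-─-outside (_ ∷ S) (_ ∷ T)     (suc y) eq = lookup-─-outside S T y eq

module NoFixedPoints {m k : ℕ} (N : GrassmannNecklace (suc m) k) (σ : Permutation′ (suc m))
                     (col : Fin (suc m) → Bool) (isN : IsNecklaceOf N σ col)
                     (σ-nofix : ∀ x → σ ⟨$⟩ʳ x ≢ x) where
  private
    n = suc m
  open IsNecklaceOf isN

  lookup-self : (x : Fin n) → lookup (set N x) x ≡ true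
  lookup-self x with lookup (set N x) x in eq
  ... | true  = refl
  ... | false = ⊥-elim (σ-nofix x (fixed x λ x∈ → case trans (sym eq) ([]=⇒lookup x∈) of λ ()))

  lookup-next : (p y : Fin n) →
                lookup (set N (next p)) y ≡ lookup (set N p ─ ⁅ p ⁆) y ∨ lookup ⁅ σ ⟨$⟩ʳ p ⁆ y
  lookup-next p y = trans (cong (λ S → lookup S y) (moved p (lookup⇒[]= p (set N p) (lookup-self p))))
    (lookup-zipWith _∨_ y (set N p - p) ⁅ σ ⟨$⟩ʳ p ⁆)

  step-other : (p y : Fin n) → y ≢ p → y ≢ σ ⟨$⟩ʳ p → lookup (set N (next p)) y ≡ lookup (set N p) y
  step-other p y y≢p y≢σp = begin
    lookup (set N (next p)) y
      ≡⟨ lookup-next p y ⟩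
    lookup (set N p ─ ⁅ p ⁆) y ∨ lookup ⁅ σ ⟨$⟩ʳ p ⁆ y
      ≡⟨ cong₂ _∨_ (lookup-─-outside (set N p) ⁅ p ⁆ y (lookup-⁅y⁆ y≢p)) (lookup-⁅y⁆ y≢σp) ⟩
    lookup (set N p) y ∨ false
      ≡⟨ ∨-identityʳ _ ⟩
    lookup (set N p) y
      ∎
    where open ≡-Reasoning

  step-leaves : (p : Fin n) → lookup (set N (next p)) p ≡ false
  step-leaves p = trans (lookup-next p p)
    (cong₂ _∨_ (lookup-─-inside (set N p) ⁅ p ⁆ p (lookup-⁅x⁆ p)) (lookup-⁅y⁆ (λ eq → σ-nofix p (sym eq))))

  step-enters : (p : Fin n) → lookup (set N (next p)) (σ ⟨$⟩ʳ p) ≡ true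
  step-enters p = trans (lookup-next p (σ ⟨$⟩ʳ p))
    (trans (cong (lookup (set N p ─ ⁅ p ⁆) (σ ⟨$⟩ʳ p) ∨_) (lookup-⁅x⁆ (σ ⟨$⟩ʳ p))) (∨-zeroʳ _))

  -- Walking around the circle from i, j leaves the necklace when the walk passes j and
  -- enters it when the walk passes σ⁻¹ j; so j ∈ N i iff the walk reaches j first.
  module _ (i j : Fin n) where
    private
      leave enter : ℕ
      leave = shift i j
      enter = shift i (σ ⟨$⟩ˡ j)

      mem : ℕ → Bool
      mem s = lookup (set N (advance s i)) j

      mem-suc : ∀ s → s < n → s ≢ leave → s ≢ enter → mem (suc s) ≡ mem s
      mem-suc s s<n s≢leave s≢enter = trans (cong (λ z → lookup (set N z) j) (advance-suc s i))
        (step-other (advance s i) j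
          (λ j≡ → s≢leave (sym (trans (cong (shift i) j≡) (shift-advance i s<n))))
          (λ j≡ → s≢enter (sym (trans (cong (shift i) (trans (cong (σ ⟨$⟩ˡ_) j≡) (inverseˡ σ)))
                                      (shift-advance i s<n)))))

      mem-constant : ∀ a d → a + d ≤ n → (∀ s → a ≤ s → s < a + d → s ≢ leave × s ≢ enter) →
                     mem (a + d) ≡ mem a
      mem-constant a zero    _         _    = cong mem (+-identityʳ a)
      mem-constant a (suc d) a+1+d≤n free = begin
        mem (a + suc d)    ≡⟨ cong mem (+-suc a d) ⟩
        mem (suc (a + d))  ≡⟨ mem-suc (a + d) (subst (_≤ n) (+-suc a d) a+1+d≤n)
                                (proj₁ (free (a + d) (m≤m+n a d) a+d<a+1+d))
                                (proj₂ (free (a + d) (m≤m+n a d) a+d<a+1+d)) ⟩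
        mem (a + d)        ≡⟨ mem-constant a d (≤-trans (+-monoʳ-≤ a (n≤1+n d)) a+1+d≤n)
                                (λ s a≤s s<a+d → free s a≤s (<-trans s<a+d a+d<a+1+d)) ⟩
        mem a              ∎
        where
        open ≡-Reasoning
        a+d<a+1+d : a + d < a + suc d
        a+d<a+1+d = +-monoʳ-< a ≤-refl

      mem-leave : mem leave ≡ true
      mem-leave = trans (cong (λ z → lookup (set N z) j) (advance-shift i j)) (lookup-self j)

    ∈-necklace : leave < enter → lookup (set N i) j ≡ true
    ∈-necklace leave<enter = trans
      (sym (mem-constant 0 leave (<⇒≤ (shift<n i j)) λ s _ s<leave →
        <⇒≢ s<leave , <⇒≢ (<-trans s<leave leave<enter)))
      mem-leave

    ∉-necklace : enter < leave → lookup (set N i) j ≡ false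
    ∉-necklace enter<leave = begin
      lookup (set N i) j
        ≡⟨ cong (λ z → lookup (set N z) j) (advance-n i) ⟨
      mem n
        ≡⟨ cong mem (m+[n∸m]≡n (shift<n i j)) ⟨
      mem (suc leave + (n ∸ suc leave))
        ≡⟨ mem-constant (suc leave) (n ∸ suc leave) (≤-reflexive (m+[n∸m]≡n (shift<n i j)))
             (λ s leave<s _ → >⇒≢ leave<s , >⇒≢ (<-trans enter<leave leave<s)) ⟩
      mem (suc leave)
        ≡⟨ cong (λ z → lookup (set N z) j) (advance-suc leave i) ⟩
      lookup (set N (next (advance leave i))) j
        ≡⟨ cong (λ z → lookup (set N (next z)) j) (advance-shift i j) ⟩
      lookup (set N (next j)) j
        ≡⟨ step-leaves j ⟩
      false
        ∎
      where open ≡-Reasoning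

-- The necklace of π⁻¹ is dual to the necklace of π

module Duality {m k l : ℕ} (π : Permutation′ (suc m)) (col : Fin (suc m) → Bool)
               (I : GrassmannNecklace (suc m) k) (J : GrassmannNecklace (suc m) l)
               (isI : IsNecklaceOf I π col) (isJ : IsNecklaceOf J (flip π) col)
               (π-nofix : ∀ x → π ⟨$⟩ʳ x ≢ x) where
  private
    n = suc m

  π⁻¹-nofix : ∀ x → flip π ⟨$⟩ʳ x ≢ x
  π⁻¹-nofix x eq = π-nofix x (trans (cong (π ⟨$⟩ʳ_) (sym eq)) (inverseʳ π))

  module NI = NoFixedPoints I π col isI π-nofix
  module NJ = NoFixedPoints J (flip π) col isJ π⁻¹-nofix

  module _ (i : Fin n) (t : ℕ) (t<n : t < n) where
    private
      p = advance t i
      v = shift i (π ⟨$⟩ʳ p)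

      t≢v : t ≢ v
      t≢v t≡v = π-nofix p (sym (trans (cong (λ z → advance z i) t≡v) (advance-shift i (π ⟨$⟩ʳ p))))

      unchanged-before : ∀ q → q < t → q ≢ v → member (set I (next p)) i q ≡ member (set I p) i q
      unchanged-before q q<t q≢v = NI.step-other p (advance q i)
        (λ eq → <⇒≢ q<t (advance-injective i (<-trans q<t t<n) t<n eq))
        (λ eq → q≢v (trans (sym (shift-advance i (<-trans q<t t<n))) (cong (shift i) eq)))

      πp∉Iₚ : lookup (set I p) (π ⟨$⟩ʳ p) ≡ false
      πp∉Iₚ = NI.∉-necklace p (π ⟨$⟩ʳ p) (begin-strict
        shift p (π ⟨$⟩ˡ (π ⟨$⟩ʳ p))  ≡⟨ cong (shift p) (inverseˡ π) ⟩
        shift p p                    ≡⟨ shift-self p ⟩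
        0                            <⟨ n≢0⇒n>0 shift≢0 ⟩
        shift p (π ⟨$⟩ʳ p)           ∎)
        where
        open ≤-Reasoning
        shift≢0 : shift p (π ⟨$⟩ʳ p) ≢ 0
        shift≢0 eq = π-nofix p (trans (sym (advance-shift p (π ⟨$⟩ʳ p))) (cong (λ z → advance z p) eq))

      exchange-before : t < v →
        bit (lookup (set J i) p) + countFrom (set I (next p)) i t ≡ suc (countFrom (set I p) i t)
      exchange-before t<v = cong₂ _+_
        (cong bit (NJ.∈-necklace i p (subst (_< v) (sym (shift-advance i t<n)) t<v)))
        (count-cong _ _ 0 t λ q _ q<t → unchanged-before q q<t (<⇒≢ (<-trans q<t t<v)))

      exchange-after : v < t →
        bit (lookup (set J i) p) + countFrom (set I (next p)) i t ≡ suc (countFrom (set I p) i t)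
      exchange-after v<t = cong₂ _+_
        (cong bit (NJ.∉-necklace i p (subst (v <_) (sym (shift-advance i t<n)) v<t)))
        (count-single-difference _ _ v 0 t z≤n v<t
          (trans (cong (lookup (set I (next p))) (advance-shift i (π ⟨$⟩ʳ p))) (NI.step-enters p))
          (trans (cong (lookup (set I p)) (advance-shift i (π ⟨$⟩ʳ p))) πp∉Iₚ)
          λ q _ q<t q≢v → unchanged-before q q<t q≢v)

    -- Passing p replaces p by π p in the necklace of π. Exactly one of two things
    -- happens: p ∈ J i (when π p lies beyond p), or the first t positions gain π p.
    exchange : bit (lookup (set J i) p) + countFrom (set I (next p)) i t ≡ suc (countFrom (set I p) i t)
    exchange with <-cmp t v
    ... | tri< t<v _   _   = exchange-before t<v
    ... | tri≈ _   t≡v _   = ⊥-elim (t≢v t≡v)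
    ... | tri> _   _   v<t = exchange-after v<t

  duality : ∀ t → t ≤ n → ∀ i → countFrom (set J i) i t + countFrom (set I (advance t i)) i t ≡ t
  duality zero    _   i = refl
  duality (suc t) t<n i = begin
    countFrom (set J i) i (suc t) + countFrom (set I (advance (suc t) i)) i (suc t)
      ≡⟨ cong₂ _+_ (countFrom-snoc (set J i) i t) (cong (λ z → countFrom (set I z) i (suc t)) (advance-suc t i)) ⟩
    (cJ + b) + countFrom I′ i (suc t)
      ≡⟨ cong ((cJ + b) +_) (countFrom-snoc I′ i t) ⟩
    (cJ + b) + (cI′ + bit (lookup I′ p))
      ≡⟨ cong (λ x → (cJ + b) + (cI′ + bit x)) (NI.step-leaves p) ⟩
    (cJ + b) + (cI′ + 0)
      ≡⟨ trans (cong ((cJ + b) +_) (+-identityʳ cI′)) (+-assoc cJ b cI′) ⟩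
    cJ + (b + cI′)
      ≡⟨ cong (cJ +_) (exchange i t t<n) ⟩
    cJ + suc (countFrom (set I p) i t)
      ≡⟨ +-suc cJ _ ⟩
    suc (cJ + countFrom (set I p) i t)
      ≡⟨ cong suc (duality t (<⇒≤ t<n) i) ⟩
    suc t
      ∎
    where
    open ≡-Reasoning
    p = advance t i
    I′ = set I (next p)
    cJ = countFrom (set J i) i t
    cI′ = countFrom I′ i t
    b = bit (lookup (set J i) p)

  l+k≡n : l + k ≡ n
  l+k≡n = begin
    l + k
      ≡⟨ cong₂ _+_ (size J zero) (size I (advance n zero)) ⟨
    ∣ set J zero ∣ + ∣ set I (advance n zero) ∣
      ≡⟨ cong₂ _+_ (countFrom-full (set J zero) zero) (countFrom-full (set I (advance n zero)) zero) ⟨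
    countFrom (set J zero) zero n + countFrom (set I (advance n zero)) zero n
      ≡⟨ duality n ≤-refl zero ⟩
    n
      ∎
    where open ≡-Reasoning

  ∣∁S∣≡k⇔∣S∣≡l : (S : Subset n) → ∣ ∁ S ∣ ≡ k ⇔ ∣ S ∣ ≡ l
  ∣∁S∣≡k⇔∣S∣≡l S = mk⇔
    (λ ∣∁S∣≡k → +-cancelˡ-≡ k _ _ (trans (cong (_+ ∣ S ∣) (sym ∣∁S∣≡k)) sizes))
    (λ ∣S∣≡l → +-cancelʳ-≡ _ _ _ (trans (cong (∣ ∁ S ∣ +_) (sym ∣S∣≡l)) sizes))
    where
    sizes : ∣ ∁ S ∣ + ∣ S ∣ ≡ k + l
    sizes = trans (∣∁X∣+∣X∣≡n S) (trans (sym l+k≡n) (+-comm l k))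

  ≤-by-complements : ∀ {x a b y z w s t l k} → x + a ≡ s → a + b ≡ l → y + z ≡ k → w + z ≡ t →
                     b ≤ w → s + t ≡ l + k → x ≤ y
  ≤-by-complements {x} {a} {b} {y} {z} {w} {s} {t} {l} {k} x+a≡s a+b≡l y+z≡k w+z≡t b≤w s+t≡l+k =
    +-cancelʳ-≤ (a + t) x y (begin
      x + (a + t)        ≡⟨ +-assoc x a t ⟨
      x + a + t          ≡⟨ cong (_+ t) x+a≡s ⟩
      s + t              ≡⟨ s+t≡l+k ⟩
      l + k              ≡⟨ cong₂ _+_ a+b≡l y+z≡k ⟨
      (a + b) + (y + z)  ≤⟨ +-monoˡ-≤ (y + z) (+-monoʳ-≤ a b≤w) ⟩
      (a + w) + (y + z)  ≡⟨ solve 4 (λ a w y z → (a :+ w) :+ (y :+ z) := y :+ (a :+ (w :+ z))) refl a w y z ⟩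
      y + (a + (w + z))  ≡⟨ cong (λ u → y + (a + u)) w+z≡t ⟩
      y + (a + t)        ∎)
    where open ≤-Reasoning

  -- Each prefix bound is read off the complementary arc starting at i′ = i + s,
  -- where the Gale condition at i′ and the duality identity apply.
  ∁-positroid : ∀ S → InPositroid J S → InPositroid I (∁ S)
  ∁-positroid S (∣S∣≡l , S∈J) = ∣∁S∣≡k , λ i →
    prefix⇒galeLeq i (set I i) (∁ S) (trans (size I i) (sym ∣∁S∣≡k)) (prefix i)
    where
    ∣∁S∣≡k : ∣ ∁ S ∣ ≡ k
    ∣∁S∣≡k = Equivalence.from (∣∁S∣≡k⇔∣S∣≡l S) ∣S∣≡l
    prefix : ∀ i s → s ≤ n → countFrom (∁ S) i s ≤ countFrom (set I i) i s
    prefix i s s≤n = ≤-by-complements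
      (countFrom-∁ S i s)
      (trans (countFrom-arcs S i s t s+t≡n) ∣S∣≡l)
      (trans (countFrom-arcs (set I i) i s t s+t≡n) (size I i))
      (subst (λ z → countFrom (set J i′) i′ t + countFrom (set I z) i′ t ≡ t)
        (advance-around i s t s+t≡n) (duality t (m∸n≤m n s) i′))
      (galeLeq⇒prefix i′ (set J i′) S (S∈J i′) t (m∸n≤m n s))
      (trans s+t≡n (sym l+k≡n))
      where
      t = n ∸ s
      i′ = advance s i
      s+t≡n : s + t ≡ n
      s+t≡n = m+[n∸m]≡n s≤n

  ∁-positroid⁻¹ : ∀ S → InPositroid I (∁ S) → InPositroid J S
  ∁-positroid⁻¹ S (∣∁S∣≡k , ∁S∈I) = ∣S∣≡l , λ i →
    prefix⇒galeLeq i (set J i) S (trans (size J i) (sym ∣S∣≡l)) (prefix i)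
    where
    ∣S∣≡l : ∣ S ∣ ≡ l
    ∣S∣≡l = Equivalence.to (∣∁S∣≡k⇔∣S∣≡l S) ∣∁S∣≡k
    prefix : ∀ i s → s ≤ n → countFrom S i s ≤ countFrom (set J i) i s
    prefix i s s≤n = ≤-by-complements
      (trans (countFrom-arcs S i s t s+t≡n) ∣S∣≡l)
      (trans (+-comm (countFrom S i′ t) _) (countFrom-∁ S i′ t))
      (duality s s≤n i)
      (subst (λ z → countFrom (set I i′) i′ t + countFrom (set I i′) z s ≡ k) (advance-around i s t s+t≡n)
        (trans (countFrom-arcs (set I i′) i′ t s t+s≡n) (size I i′)))
      (galeLeq⇒prefix i′ (set I i′) (∁ S) (∁S∈I i′) t (m∸n≤m n s))
      (trans l+k≡n (sym t+s≡n))
      where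
      t = n ∸ s
      i′ = advance s i
      s+t≡n : s + t ≡ n
      s+t≡n = m+[n∸m]≡n s≤n
      t+s≡n : t + s ≡ n
      t+s≡n = trans (+-comm t s) s+t≡n

-- Exchange graph isomorphisms induced by involutions of the subsets

module Pullback {n : ℕ} (φ : Subset n → Subset n) (φ-involutive : ∀ S → φ (φ S) ≡ S)
                (φ-separated : ∀ S T → WeaklySeparated (φ T) (φ S) → WeaklySeparated S T) where

  pullback : Collection n → Collection n
  pullback C S = C (φ S)

  pullback-involutive : ∀ C S → pullback (pullback C) S ≡ C S
  pullback-involutive C S = cong C (φ-involutive S)

  pullback-wsc : ∀ {a b} (A : GrassmannNecklace n a) (B : GrassmannNecklace n b) →
                 (∀ S → InPositroid A (φ S) → InPositroid B S) →
                 ∀ C → WSCollection A C → WSCollection B (pullback C)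
  pullback-wsc A B A→B C (C⊆A , C-sep) =
      (λ S φS∈C → A→B S (C⊆A (φ S) φS∈C))
    , (λ S T φS∈C φT∈C → φ-separated S T (C-sep (φ T) (φ S) φT∈C φS∈C))

  pullback-vertex : ∀ {a b} (A : GrassmannNecklace n a) (B : GrassmannNecklace n b) →
                    (∀ S → InPositroid A (φ S) → InPositroid B S) →
                    (∀ S → InPositroid B (φ S) → InPositroid A S) →
                    ∀ C → MaxWSC A C → MaxWSC B (pullback C)
  pullback-vertex A B A→B B→A C (C-wsc , C-max) = pullback-wsc A B A→B C C-wsc , λ D D-wsc C⊆D S S∈D →
    C-max (pullback D) (pullback-wsc B A B→A D D-wsc)
          (λ U U∈C → C⊆D (φ U) (trans (pullback-involutive C U) U∈C))
          (φ S) (trans (pullback-involutive D S) S∈D)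

  pullback-mutation : ∀ C C′ → Mutation C C′ → Mutation (pullback C) (pullback C′)
  pullback-mutation C C′ (S , T , S≢T , S∈C , S∉C′ , T∈C′ , T∉C , C≗C′) =
      φ S , φ T , (λ φS≡φT → S≢T (φ-injective φS≡φT))
    , trans (pullback-involutive C S) S∈C , trans (pullback-involutive C′ S) S∉C′
    , trans (pullback-involutive C′ T) T∈C′ , trans (pullback-involutive C T) T∉C
    , λ U U≢φS U≢φT → C≗C′ (φ U) (λ φU≡S → U≢φS (φ-swap φU≡S)) (λ φU≡T → U≢φT (φ-swap φU≡T))
    where
    φ-swap : ∀ {U V} → φ U ≡ V → U ≡ φ V
    φ-swap {U} φU≡V = trans (sym (φ-involutive U)) (cong φ φU≡V)
    φ-injective : ∀ {U V} → φ U ≡ φ V → U ≡ V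
    φ-injective {V = V} φU≡φV = trans (φ-swap φU≡φV) (φ-involutive V)

  exchangeGraphIso : ∀ {k l} (I : GrassmannNecklace n k) (J : GrassmannNecklace n l) →
                     (∀ S → InPositroid I (φ S) → InPositroid J S) →
                     (∀ S → InPositroid J (φ S) → InPositroid I S) →
                     ExchangeGraphIso I J
  exchangeGraphIso I J I→J J→I = record
    { to          = pullback
    ; from        = pullback
    ; to-cong     = λ C C′ C≐C′ S → C≐C′ (φ S)
    ; from-cong   = λ D D′ D≐D′ S → D≐D′ (φ S)
    ; to-vertex   = pullback-vertex I J I→J J→I
    ; from-vertex = pullback-vertex J I J→I I→J
    ; from-to     = λ C _ → pullback-involutive C
    ; to-from     = λ D _ → pullback-involutive D
    ; edge-to     = λ C C′ _ _ → pullback-mutation C C′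
    ; edge-from   = λ D D′ _ _ → pullback-mutation D D′
    }

∁-involutive : ∀ {n} (S : Subset n) → ∁ (∁ S) ≡ S
∁-involutive []      = refl
∁-involutive (x ∷ S) = cong₂ _∷_ (not-involutive x) (∁-involutive S)

∁-separated : ∀ {n} (S T : Subset n) → WeaklySeparated (∁ T) (∁ S) → WeaklySeparated S T
∁-separated S T ∁T∥∁S a b c d abcd (a∈S , a∉T , c∈S , c∉T , b∈T , b∉S , d∈T , d∉S) =
  ∁T∥∁S a b c d abcd ( x∉p⇒x∈∁p a∉T , x∈p⇒x∉∁p a∈S , x∉p⇒x∈∁p c∉T , x∈p⇒x∉∁p c∈S
                     , x∉p⇒x∈∁p b∉S , x∈p⇒x∉∁p b∈T , x∉p⇒x∈∁p d∉S , x∈p⇒x∉∁p d∈T )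

-- Connected positroids on at least two elements have no loops or coloops

∣S∩⊥∣≡0 : ∀ {n} (S : Subset n) → ∣ S ∩ Subset.⊥ ∣ ≡ 0
∣S∩⊥∣≡0 []          = refl
∣S∩⊥∣≡0 (true  ∷ S) = ∣S∩⊥∣≡0 S
∣S∩⊥∣≡0 (false ∷ S) = ∣S∩⊥∣≡0 S

∣S∩⁅x⁆∣≡bit : ∀ {n} (S : Subset n) (x : Fin n) → ∣ S ∩ ⁅ x ⁆ ∣ ≡ bit (lookup S x)
∣S∩⁅x⁆∣≡bit (true  ∷ S) zero    = cong suc (∣S∩⊥∣≡0 S)
∣S∩⁅x⁆∣≡bit (false ∷ S) zero    = ∣S∩⊥∣≡0 S
∣S∩⁅x⁆∣≡bit (true  ∷ S) (suc x) = ∣S∩⁅x⁆∣≡bit S x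
∣S∩⁅x⁆∣≡bit (false ∷ S) (suc x) = ∣S∩⁅x⁆∣≡bit S x

module _ {m k : ℕ} (I : GrassmannNecklace (suc m) k) {π : Permutation′ (suc m)} {col : Fin (suc m) → Bool}
         (isI : IsNecklaceOf I π col) where
  private
    n = suc m
  open IsNecklaceOf isI

  coloop-stays : (i : Fin n) → π ⟨$⟩ʳ i ≡ i → lookup (set I i) i ≡ true → lookup (set I (next i)) i ≡ true
  coloop-stays i πi≡i Iᵢ∋i = begin
    lookup (set I (next i)) i
      ≡⟨ cong (λ S → lookup S i) (moved i (lookup⇒[]= i (set I i) Iᵢ∋i)) ⟩
    lookup ((set I i - i) ∪ ⁅ π ⟨$⟩ʳ i ⁆) i
      ≡⟨ lookup-zipWith _∨_ i (set I i - i) ⁅ π ⟨$⟩ʳ i ⁆ ⟩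
    lookup (set I i - i) i ∨ lookup ⁅ π ⟨$⟩ʳ i ⁆ i
      ≡⟨ cong (λ x → lookup (set I i - i) i ∨ lookup ⁅ x ⁆ i) πi≡i ⟩
    lookup (set I i - i) i ∨ lookup ⁅ i ⁆ i
      ≡⟨ cong (lookup (set I i - i) i ∨_) (lookup-⁅x⁆ i) ⟩
    lookup (set I i - i) i ∨ true
      ≡⟨ ∨-zeroʳ _ ⟩
    true
      ∎
    where open ≡-Reasoning

  -- For a loop i, the Gale condition at i on the first position keeps i out of B; for a
  -- coloop, the one at i + 1 on all positions but the last, which is i, forces i into B.
  fixed-point-forced : (i : Fin n) → π ⟨$⟩ʳ i ≡ i → ∀ B → InPositroid I B → lookup B i ≡ lookup (set I i) i
  fixed-point-forced i πi≡i B (∣B∣≡k , B∈I) with lookup (set I i) i in Iᵢ∋i | lookup B i in B∋i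
  ... | false | false = refl
  ... | true  | true  = refl
  ... | false | true  = ⊥-elim (1+n≰n (begin
    1                        ≡⟨ cong (λ b → bit b + 0) B∋i ⟨
    countFrom B i 1          ≤⟨ galeLeq⇒prefix i (set I i) B (B∈I i) 1 (s≤s z≤n) ⟩
    countFrom (set I i) i 1  ≡⟨ cong (λ b → bit b + 0) Iᵢ∋i ⟩
    0                        ∎))
    where open ≤-Reasoning
  ... | true  | false = ⊥-elim (1+n≰n (begin
    suc (countFrom I′ (next i) m)                ≡⟨ +-comm 1 _ ⟩
    countFrom I′ (next i) m + 1                  ≡⟨ cong (λ b → countFrom I′ (next i) m + bit b)
                                                         (coloop-stays i πi≡i Iᵢ∋i) ⟨
    countFrom I′ (next i) m + bit (lookup I′ i)  ≡⟨ trans (countFrom-around I′ i) (size I (next i)) ⟩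
    k                                            ≡⟨ trans (countFrom-around B i) ∣B∣≡k ⟨
    countFrom B (next i) m + bit (lookup B i)    ≡⟨ cong (λ b → countFrom B (next i) m + bit b) B∋i ⟩
    countFrom B (next i) m + 0                   ≡⟨ +-identityʳ _ ⟩
    countFrom B (next i) m                       ≤⟨ galeLeq⇒prefix (next i) I′ B (B∈I (next i)) m (n≤1+n m) ⟩
    countFrom I′ (next i) m                      ∎))
    where
    open ≤-Reasoning
    I′ = set I (next i)

connected⇒no-fixed-points : ∀ {m k} (I : GrassmannNecklace (suc (suc m)) k) {π col} →
                            IsNecklaceOf I π col → Connected I → ∀ x → π ⟨$⟩ʳ x ≢ x
connected⇒no-fixed-points {m} I isI connected x πx≡x =
  connected ⁅ x ⁆ (x , x∈⁅x⁆ x) (other x , x∉p⇒x∈∁p (x≢y⇒x∉⁅y⁆ (other≢ x))) λ B C B∈I C∈I → begin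
    ∣ B ∩ ⁅ x ⁆ ∣             ≡⟨ ∣S∩⁅x⁆∣≡bit B x ⟩
    bit (lookup B x)          ≡⟨ cong bit (fixed-point-forced I isI x πx≡x B B∈I) ⟩
    bit (lookup (set I x) x)  ≡⟨ cong bit (fixed-point-forced I isI x πx≡x C C∈I) ⟨
    bit (lookup C x)          ≡⟨ ∣S∩⁅x⁆∣≡bit C x ⟨
    ∣ C ∩ ⁅ x ⁆ ∣             ∎
  where
  open ≡-Reasoning
  other : Fin (suc (suc m)) → Fin (suc (suc m))
  other zero    = suc zero
  other (suc _) = zero
  other≢ : ∀ y → other y ≢ y
  other≢ zero    ()
  other≢ (suc _) ()

-- The only subset of [0] is [], which lies in the positroid iff k = 0.
empty-collection : ℕ → Collection 0
empty-collection k _ = k ≡ᵇ 0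

[]∈positroid : ∀ {k} (I : GrassmannNecklace 0 k) → [] ∈C empty-collection k → InPositroid I []
[]∈positroid {zero} I _ = refl , λ ()

[]∈positroid⁻¹ : ∀ {k} (I : GrassmannNecklace 0 k) → InPositroid I [] → [] ∈C empty-collection k
[]∈positroid⁻¹ I (refl , _) = refl

empty-collection-vertex : ∀ {k} (I : GrassmannNecklace 0 k) → MaxWSC I (empty-collection k)
empty-collection-vertex I = ((λ { [] → []∈positroid I }) , (λ S T _ _ ()))
                          , λ D (D⊆I , _) _ → λ { [] []∈D → []∈positroid⁻¹ I (D⊆I [] []∈D) }

vertex≐empty-collection : ∀ {k} (I : GrassmannNecklace 0 k) C → MaxWSC I C → empty-collection k ≐ C
vertex≐empty-collection {zero} I C (_ , C-max) [] =
  sym (C-max (empty-collection 0) (proj₁ (empty-collection-vertex I)) (λ _ _ → refl) [] refl)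
vertex≐empty-collection {suc k} I C ((C⊆I , _) , _) [] with C [] in []∈C
... | true  = case proj₁ (C⊆I [] []∈C) of λ ()
... | false = refl

no-mutation₀ : ∀ (C D : Collection 0) → ¬ Mutation C D
no-mutation₀ C D ([] , [] , []≢[] , _) = []≢[] refl

exchangeGraphIso₀ : ∀ {k l} (I : GrassmannNecklace 0 k) (J : GrassmannNecklace 0 l) → ExchangeGraphIso I J
exchangeGraphIso₀ {k} {l} I J = record
  { to          = λ _ → empty-collection l
  ; from        = λ _ → empty-collection k
  ; to-cong     = λ _ _ _ _ → refl
  ; from-cong   = λ _ _ _ _ → refl
  ; to-vertex   = λ _ _ → empty-collection-vertex J
  ; from-vertex = λ _ _ → empty-collection-vertex I
  ; from-to     = vertex≐empty-collection I
  ; to-from     = vertex≐empty-collection J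
  ; edge-to     = λ C C′ _ _ C—C′ → ⊥-elim (no-mutation₀ C C′ C—C′)
  ; edge-from   = λ D D′ _ _ D—D′ → ⊥-elim (no-mutation₀ D D′ D—D′)
  }

necklace₁-colour : ∀ {k} (N : GrassmannNecklace 1 k) {σ col} →
                   IsNecklaceOf N σ col → lookup (set N zero) zero ≡ col zero
necklace₁-colour N {σ} {col} isN with IsNecklaceOf.colour isN zero (only-zero (σ ⟨$⟩ʳ zero))
  where
  only-zero : (x : Fin 1) → x ≡ zero
  only-zero zero = refl
... | (N∋0⇒col , col⇒N∋0) with lookup (set N zero) zero in N∋0 | col zero
...   | true  | true  = refl
...   | false | false = refl
...   | true  | false = sym (N∋0⇒col (lookup⇒[]= zero (set N zero) N∋0))
...   | false | true  = trans (sym N∋0) ([]=⇒lookup (col⇒N∋0 refl))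

exchangeGraphIso₁ : ∀ {k l} (I : GrassmannNecklace 1 k) (J : GrassmannNecklace 1 l) {π col} →
                    IsNecklaceOf I π col → IsNecklaceOf J (flip π) col → ExchangeGraphIso I J
exchangeGraphIso₁ I J isI isJ =
  Pullback.exchangeGraphIso id (λ _ → refl) separated I J (transfer I J I₀≡J₀) (transfer J I (sym I₀≡J₀))
  where
  I₀≡J₀ : set I zero ≡ set J zero
  I₀≡J₀ with set I zero | set J zero | necklace₁-colour I isI | necklace₁-colour J isJ
  ... | x ∷ [] | y ∷ [] | x≡col | y≡col = cong (_∷ []) (trans x≡col (sym y≡col))
  transfer : ∀ {a b} (A : GrassmannNecklace 1 a) (B : GrassmannNecklace 1 b) →
             set A zero ≡ set B zero → ∀ S → InPositroid A S → InPositroid B S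
  transfer A B A₀≡B₀ S (∣S∣≡a , S∈A) =
      trans ∣S∣≡a (trans (sym (size A zero)) (trans (cong ∣_∣ A₀≡B₀) (size B zero)))
    , λ { zero → subst (λ X → GaleLeq zero X S) A₀≡B₀ (S∈A zero) }
  separated : ∀ S T → WeaklySeparated T S → WeaklySeparated S T
  separated S T _ zero zero _ _ (() , _)

proposition3p3 : (n k l : ℕ) (π : Permutation′ n) (col : Fin n → Bool)
                 (I : GrassmannNecklace n k) (J : GrassmannNecklace n l) →
                 Connected I → IsNecklaceOf I π col → IsNecklaceOf J (flip π) col →
                 ExchangeGraphIso I J
proposition3p3 zero          k l π col I J _         _   _   = exchangeGraphIso₀ I J
proposition3p3 (suc zero)    k l π col I J _         isI isJ = exchangeGraphIso₁ I J isI isJ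
proposition3p3 (suc (suc m)) k l π col I J connected isI isJ =
  Pullback.exchangeGraphIso ∁ ∁-involutive ∁-separated I J
    D.∁-positroid⁻¹
    (λ S ∁S∈J → subst (InPositroid I) (∁-involutive S) (D.∁-positroid (∁ S) ∁S∈J))
  where
  module D = Duality π col I J isI isJ (connected⇒no-fixed-points I isI connected)
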